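{- The formula $\neg\Box\bot\to(\neg\neg\Box p\to\Box\neg\neg p)$ is derivable in $\mathsf{CK}\oplus N_{\Diamond\Box}\oplus I_{\Diamond\Box}$ but not in $\mathsf{CK}$.
   Context: Formulas are built from a countably infinite set of propositional variables by $\varphi ::= p \mid \bot \mid \varphi\wedge\varphi \mid \varphi\vee\varphi \mid \varphi\to\varphi \mid \Box\varphi \mid \Diamond\varphi$; $\neg\varphi:=\varphi\to\bot$. For a set $\mathsf{Ax}$ of formulas, $\mathsf{CK}\oplus\mathsf{Ax}$ is the logic whose derivable formulas are generated by: substitution instances of axioms of a standard Hilbert axiomatisation of intuitionistic propositional logic, of $\Box(p\to q)\to(\Box p\to\Box q)$, of $\Box(p\to q)\to(\Diamond p\to\Diamond q)$, and of formulas in $\mathsf{Ax}$; modus ponens; necessitation (from $\varphi$ infer $\Box\varphi$). $\mathsf{CK}=\mathsf{CK}\oplus\emptyset$, and $\mathsf{CK}\oplus A_1\oplus A_2$ denotes $\mathsf{CK}\oplus\{A_1,A_2\}$. Axioms: $N_{\Diamond\Box}$: $\Diamond\bot\to\Box\bot$; $I_{\Diamond\Box}$: $(\Diamond p\to\Box q)\to\Box(p\to q)$. -}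

module Defs where

open import Data.Nat using (ℕ)
import Data.Empty as Empty
open import Data.Sum using (_⊎_)
open import Relation.Binary.PropositionalEquality using (_≡_)
open import Relation.Nullary using (¬_)

infixr 6 _∧_
infixr 5 _∨_
infixr 4 _⇒_

data Fm : Set where
  var  : ℕ → Fm
  ⊥'   : Fm
  _∧_  : Fm → Fm → Fm
  _∨_  : Fm → Fm → Fm
  _⇒_  : Fm → Fm → Fm
  □    : Fm → Fm
  ◇    : Fm → Fm

~ : Fm → Fm
~ φ = φ ⇒ ⊥'

Subst : Set
Subst = ℕ → Fm

_[_] : Fm → Subst → Fm
var n   [ σ ] = σ n
⊥'      [ σ ] = ⊥'
(φ ∧ ψ) [ σ ] = (φ [ σ ]) ∧ (ψ [ σ ])
(φ ∨ ψ) [ σ ] = (φ [ σ ]) ∨ (ψ [ σ ])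
(φ ⇒ ψ) [ σ ] = (φ [ σ ]) ⇒ (ψ [ σ ])
□ φ     [ σ ] = □ (φ [ σ ])
◇ φ     [ σ ] = ◇ (φ [ σ ])

p q r : Fm
p = var 0
q = var 1
r = var 2

data IPCAxiom : Fm → Set where
  ax-K    : IPCAxiom (p ⇒ q ⇒ p)
  ax-S    : IPCAxiom ((p ⇒ q ⇒ r) ⇒ (p ⇒ q) ⇒ p ⇒ r)
  ax-∧E₁  : IPCAxiom (p ∧ q ⇒ p)
  ax-∧E₂  : IPCAxiom (p ∧ q ⇒ q)
  ax-∧I   : IPCAxiom (p ⇒ q ⇒ p ∧ q)
  ax-∨I₁  : IPCAxiom (p ⇒ p ∨ q)
  ax-∨I₂  : IPCAxiom (q ⇒ p ∨ q)
  ax-∨E   : IPCAxiom ((p ⇒ r) ⇒ (q ⇒ r) ⇒ p ∨ q ⇒ r)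
  ax-⊥E   : IPCAxiom (⊥' ⇒ p)

data CKAxiom : Fm → Set where
  ax-K□ : CKAxiom (□ (p ⇒ q) ⇒ □ p ⇒ □ q)
  ax-K◇ : CKAxiom (□ (p ⇒ q) ⇒ ◇ p ⇒ ◇ q)

data _⊢_ (Ax : Fm → Set) : Fm → Set where
  ipc  : ∀ {φ} → IPCAxiom φ → (σ : Subst) → Ax ⊢ (φ [ σ ])
  ck   : ∀ {φ} → CKAxiom φ → (σ : Subst) → Ax ⊢ (φ [ σ ])
  extra : ∀ {φ} → Ax φ → (σ : Subst) → Ax ⊢ (φ [ σ ])
  mp   : ∀ {φ ψ} → Ax ⊢ (φ ⇒ ψ) → Ax ⊢ φ → Ax ⊢ ψ
  nec  : ∀ {φ} → Ax ⊢ φ → Ax ⊢ □ φ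

NoAx : Fm → Set
NoAx _ = Empty.⊥

N◇□ I◇□ : Fm
N◇□ = ◇ ⊥' ⇒ □ ⊥'
I◇□ = (◇ p ⇒ □ q) ⇒ □ (p ⇒ q)

N+I : Fm → Set
N+I φ = (φ ≡ N◇□) ⊎ (φ ≡ I◇□)

target : Fm
target = ~ (□ ⊥') ⇒ (~ (~ (□ p)) ⇒ □ (~ (~ p)))

{-# OPTIONS --safe #-}
-- Derivability: □φ gives □¬¬φ = □(¬φ → ⊥), so K◇ and N◇□ turn □φ and ◇¬φ into □⊥.
-- Hence under ¬□⊥ the assumption ◇¬φ refutes □φ, contradicting ¬¬□φ; this gives the premise
-- ◇¬φ → □⊥ of I◇□ with p, q := ¬φ, ⊥, whose conclusion is □(¬φ → ⊥) = □¬¬φ.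
-- Non-derivability: CK is sound for Heyting algebras with operators □, ◇ validating K□ and K◇.
-- In the five-element algebra 𝟚² ⊕ 1 let □ ⟨ a , b ⟩ = ⟨ a , a ⟩ and ◇ be constantly ⊥.
-- For p = ⟨ 1 , 0 ⟩ we have □⊥ = ⊥ and □p = ⟨ 1 , 1 ⟩, which is dense, so both premises
-- are ⊤; but ¬¬p = p and □¬¬p = ⟨ 1 , 1 ⟩ ≠ ⊤.
module Submission where

open import Defs
open import Data.Bool using (Bool; true; false; not; T; if_then_else_)
  renaming (_∧_ to _∧ᵇ_; _∨_ to _∨ᵇ_)
open import Data.Fin using (Fin; zero; suc; #_)
open import Data.List using (List; []; _∷_; length; lookup)
open import Data.Bool.ListAction using (all)
open import Data.List.Membership.Propositional using (_∈_)
open import Data.List.Relation.Unary.Any using (here; there)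
import Data.List.Relation.Unary.All as All
open import Data.List.Relation.Unary.All.Properties using (all⁺)
open import Data.Nat using (ℕ)
open import Data.Product using (_×_; _,_)
open import Data.Sum using (inj₁; inj₂)
open import Data.Unit using (tt)
open import Function using (_∘_)
open import Relation.Binary.PropositionalEquality using (_≡_; refl; sym; trans; cong; cong₂; module ≡-Reasoning)
open import Relation.Nullary using (¬_)

variable
  Ax : Fm → Set
  Γ : List Fm
  φ ψ χ : Fm

sub₃ : Fm → Fm → Fm → Subst
sub₃ φ ψ χ 0 = φ
sub₃ φ ψ χ 1 = ψ
sub₃ φ ψ χ _ = χ

⇒-weaken : Ax ⊢ (φ ⇒ ψ ⇒ φ)
⇒-weaken {φ = φ} {ψ = ψ} = ipc ax-K (sub₃ φ ψ ⊥')

⇒-distrib : Ax ⊢ ((φ ⇒ ψ ⇒ χ) ⇒ (φ ⇒ ψ) ⇒ φ ⇒ χ)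
⇒-distrib {φ = φ} {ψ = ψ} {χ = χ} = ipc ax-S (sub₃ φ ψ χ)

⇒-refl : Ax ⊢ (φ ⇒ φ)
⇒-refl {φ = φ} = mp (mp ⇒-distrib (⇒-weaken {ψ = φ ⇒ φ})) ⇒-weaken

⊥'-elim : Ax ⊢ (⊥' ⇒ φ)
⊥'-elim {φ = φ} = ipc ax-⊥E (sub₃ φ ⊥' ⊥')

□-K : Ax ⊢ (□ (φ ⇒ ψ) ⇒ □ φ ⇒ □ ψ)
□-K {φ = φ} {ψ = ψ} = ck ax-K□ (sub₃ φ ψ ⊥')

◇-K : Ax ⊢ (□ (φ ⇒ ψ) ⇒ ◇ φ ⇒ ◇ ψ)
◇-K {φ = φ} {ψ = ψ} = ck ax-K◇ (sub₃ φ ψ ⊥')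

□-mono : Ax ⊢ (φ ⇒ ψ) → Ax ⊢ (□ φ ⇒ □ ψ)
□-mono φ⇒ψ = mp □-K (nec φ⇒ψ)

-- Necessitation applies to theorems only; with it on hypotheses the deduction theorem would fail.
infix  2 _⨾_⊢_
infixl 5 _·_

data _⨾_⊢_ (Ax : Fm → Set) (Γ : List Fm) : Fm → Set where
  theorem : Ax ⊢ φ → Ax ⨾ Γ ⊢ φ
  hyp     : (i : Fin (length Γ)) → Ax ⨾ Γ ⊢ lookup Γ i
  _·_     : Ax ⨾ Γ ⊢ φ ⇒ ψ → Ax ⨾ Γ ⊢ φ → Ax ⨾ Γ ⊢ ψ

deduction : Ax ⨾ ψ ∷ Γ ⊢ φ → Ax ⨾ Γ ⊢ ψ ⇒ φ
deduction (theorem d)   = theorem (mp ⇒-weaken d)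
deduction (hyp zero)    = theorem ⇒-refl
deduction (hyp (suc i)) = theorem ⇒-weaken · hyp i
deduction (d · e)       = theorem ⇒-distrib · deduction d · deduction e

closed : Ax ⨾ [] ⊢ φ → Ax ⊢ φ
closed (theorem d) = d
closed (d · e)     = mp (closed d) (closed e)

⇒-¬¬ : Ax ⊢ (φ ⇒ ~ (~ φ))
⇒-¬¬ = closed (deduction (deduction (hyp (# 0) · hyp (# 1))))

module _ (N : Ax N◇□) where

  □⇒◇¬⇒□⊥ : Ax ⊢ (□ φ ⇒ ◇ (~ φ) ⇒ □ ⊥')
  □⇒◇¬⇒□⊥ = closed (deduction (deduction
    (theorem (extra N var) · (theorem ◇-K · (theorem (□-mono ⇒-¬¬) · hyp (# 1)) · hyp (# 0)))))

  ¬□⊥⇒¬¬□⇒□¬¬ : Ax I◇□ → Ax ⊢ (~ (□ ⊥') ⇒ ~ (~ (□ φ)) ⇒ □ (~ (~ φ)))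
  ¬□⊥⇒¬¬□⇒□¬¬ {φ = φ} I = closed (deduction (deduction
    (theorem (extra I (sub₃ (~ φ) ⊥' ⊥')) · deduction ◇¬⇒□⊥)))
    where
    ◇¬⇒□⊥ : Ax ⨾ ◇ (~ φ) ∷ ~ (~ (□ φ)) ∷ ~ (□ ⊥') ∷ [] ⊢ □ ⊥'
    ◇¬⇒□⊥ = theorem ⊥'-elim · (hyp (# 1) · deduction
      (hyp (# 3) · (theorem □⇒◇¬⇒□⊥ · hyp (# 0) · hyp (# 1))))

record FmAlgebra : Set₁ where
  infixr 7 _⊓_
  infixr 6 _⊔_
  infixr 5 _⇨_
  field
    Carrier     : Set
    ⊤ ⊥         : Carrier
    _⊓_ _⊔_ _⇨_ : Carrier → Carrier → Carrier
    ■ ◆         : Carrier → Carrier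

module Semantics (𝔸 : FmAlgebra) where
  open FmAlgebra 𝔸

  ⟦_⟧ : Fm → (ℕ → Carrier) → Carrier
  ⟦ var n ⟧ v = v n
  ⟦ ⊥'    ⟧ v = ⊥
  ⟦ φ ∧ ψ ⟧ v = ⟦ φ ⟧ v ⊓ ⟦ ψ ⟧ v
  ⟦ φ ∨ ψ ⟧ v = ⟦ φ ⟧ v ⊔ ⟦ ψ ⟧ v
  ⟦ φ ⇒ ψ ⟧ v = ⟦ φ ⟧ v ⇨ ⟦ ψ ⟧ v
  ⟦ □ φ   ⟧ v = ■ (⟦ φ ⟧ v)
  ⟦ ◇ φ   ⟧ v = ◆ (⟦ φ ⟧ v)

  Valid : Fm → Set
  Valid φ = ∀ v → ⟦ φ ⟧ v ≡ ⊤

  ⟦⟧-subst : ∀ φ σ v → ⟦ φ [ σ ] ⟧ v ≡ ⟦ φ ⟧ (λ n → ⟦ σ n ⟧ v)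
  ⟦⟧-subst (var n) σ v = refl
  ⟦⟧-subst ⊥'      σ v = refl
  ⟦⟧-subst (φ ∧ ψ) σ v = cong₂ _⊓_ (⟦⟧-subst φ σ v) (⟦⟧-subst ψ σ v)
  ⟦⟧-subst (φ ∨ ψ) σ v = cong₂ _⊔_ (⟦⟧-subst φ σ v) (⟦⟧-subst ψ σ v)
  ⟦⟧-subst (φ ⇒ ψ) σ v = cong₂ _⇨_ (⟦⟧-subst φ σ v) (⟦⟧-subst ψ σ v)
  ⟦⟧-subst (□ φ)   σ v = cong ■ (⟦⟧-subst φ σ v)
  ⟦⟧-subst (◇ φ)   σ v = cong ◆ (⟦⟧-subst φ σ v)

  module _ (ipc-valid : ∀ {φ} → IPCAxiom φ → Valid φ)
           (ck-valid  : ∀ {φ} → CKAxiom φ → Valid φ)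
           (ax-valid  : ∀ {φ} → Ax φ → Valid φ)
           (⇨-identityˡ : ∀ a → ⊤ ⇨ a ≡ a)
           (■-⊤ : ■ ⊤ ≡ ⊤)
           where

    sound : Ax ⊢ φ → Valid φ
    sound (ipc {φ} a σ)   v = trans (⟦⟧-subst φ σ v) (ipc-valid a _)
    sound (ck {φ} a σ)    v = trans (⟦⟧-subst φ σ v) (ck-valid a _)
    sound (extra {φ} a σ) v = trans (⟦⟧-subst φ σ v) (ax-valid a _)
    sound (nec d)         v = trans (cong ■ (sound d v)) ■-⊤
    sound (mp {φ} {ψ} d e) v = begin
      ⟦ ψ ⟧ v            ≡⟨ sym (⇨-identityˡ _) ⟩
      ⊤ ⇨ ⟦ ψ ⟧ v        ≡⟨ cong (_⇨ ⟦ ψ ⟧ v) (sym (sound e v)) ⟩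
      ⟦ φ ⟧ v ⇨ ⟦ ψ ⟧ v  ≡⟨ sound d v ⟩
      ⊤                  ∎
      where open ≡-Reasoning

-- 𝟚 × 𝟚 with a new top adjoined: the up-sets of the poset r < x, r < y,
-- where ⟨ a , b ⟩ is the up-set not containing r that contains x iff a and y iff b.
data H : Set where
  ⟨_,_⟩ : Bool → Bool → H
  top   : H

bot : H
bot = ⟨ false , false ⟩

_⊓_ : H → H → H
top       ⊓ y         = y
x         ⊓ top       = x
⟨ a , b ⟩ ⊓ ⟨ c , d ⟩ = ⟨ a ∧ᵇ c , b ∧ᵇ d ⟩

_⊔_ : H → H → H
top       ⊔ _         = top
_         ⊔ top       = top
⟨ a , b ⟩ ⊔ ⟨ c , d ⟩ = ⟨ a ∨ᵇ c , b ∨ᵇ d ⟩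

-- Below the new top this is Boolean implication, except that the old top ⟨ true , true ⟩ becomes the new one.
_⇨_ : H → H → H
top       ⇨ y         = y
⟨ _ , _ ⟩ ⇨ top       = top
⟨ a , b ⟩ ⇨ ⟨ c , d ⟩ =
  if (not a ∨ᵇ c) ∧ᵇ (not b ∨ᵇ d) then top else ⟨ not a ∨ᵇ c , not b ∨ᵇ d ⟩

■ : H → H
■ top       = top
■ ⟨ a , _ ⟩ = ⟨ a , a ⟩

H-algebra : FmAlgebra
H-algebra = record
  { Carrier = H ; ⊤ = top ; ⊥ = bot
  ; _⊓_ = _⊓_ ; _⊔_ = _⊔_ ; _⇨_ = _⇨_
  ; ■ = ■ ; ◆ = λ _ → bot
  }

open Semantics H-algebra

elements : List H
elements = ⟨ false , false ⟩ ∷ ⟨ false , true ⟩ ∷ ⟨ true , false ⟩ ∷ ⟨ true , true ⟩ ∷ top ∷ []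

∈-elements : ∀ x → x ∈ elements
∈-elements ⟨ false , false ⟩ = here refl
∈-elements ⟨ false , true  ⟩ = there (here refl)
∈-elements ⟨ true  , false ⟩ = there (there (here refl))
∈-elements ⟨ true  , true  ⟩ = there (there (there (here refl)))
∈-elements top               = there (there (there (there (here refl))))

every : (H → Bool) → Bool
every f = all f elements

every-sound : ∀ f → T (every f) → ∀ x → T (f x)
every-sound f h x = All.lookup (all⁺ f elements h) (∈-elements x)

every₃ : (H → H → H → Bool) → Bool
every₃ f = every λ a → every λ b → every (f a b)

every₃-sound : ∀ f → T (every₃ f) → ∀ a b c → T (f a b c)
every₃-sound f h a b c =
  every-sound (f a b) (every-sound (every ∘ f a) (every-sound (λ a → every (every ∘ f a)) h a) b) c

isTop : H → Bool
isTop top       = true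
isTop ⟨ _ , _ ⟩ = false

isTop-sound : ∀ x → T (isTop x) → x ≡ top
isTop-sound top       _  = refl
isTop-sound ⟨ _ , _ ⟩ ()

env : H → H → H → ℕ → H
env a b c 0 = a
env a b c 1 = b
env a b c _ = c

-- For φ built from p, q, r the value ⟦ φ ⟧ (env (v 0) (v 1) (v 2)) is definitionally ⟦ φ ⟧ v,
-- so for each concrete such φ this conclusion is accepted as Valid φ.
valid-by-checking : ∀ φ → T (every₃ λ a b c → isTop (⟦ φ ⟧ (env a b c)))
                  → (v : ℕ → H) → ⟦ φ ⟧ (env (v 0) (v 1) (v 2)) ≡ top
valid-by-checking φ h v =
  isTop-sound _ (every₃-sound (λ a b c → isTop (⟦ φ ⟧ (env a b c))) h (v 0) (v 1) (v 2))

ipc-valid : IPCAxiom φ → Valid φ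
ipc-valid {φ} ax-K   = valid-by-checking φ tt
ipc-valid {φ} ax-S   = valid-by-checking φ tt
ipc-valid {φ} ax-∧E₁ = valid-by-checking φ tt
ipc-valid {φ} ax-∧E₂ = valid-by-checking φ tt
ipc-valid {φ} ax-∧I  = valid-by-checking φ tt
ipc-valid {φ} ax-∨I₁ = valid-by-checking φ tt
ipc-valid {φ} ax-∨I₂ = valid-by-checking φ tt
ipc-valid {φ} ax-∨E  = valid-by-checking φ tt
ipc-valid {φ} ax-⊥E  = valid-by-checking φ tt

ck-valid : CKAxiom φ → Valid φ
ck-valid {φ} ax-K□ = valid-by-checking φ tt
ck-valid {φ} ax-K◇ = valid-by-checking φ tt

target-invalid : ¬ Valid target
target-invalid valid with () ← valid (λ _ → ⟨ true , false ⟩)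

CK⊬target : ¬ (NoAx ⊢ target)
CK⊬target = target-invalid ∘ sound ipc-valid ck-valid (λ ()) (λ _ → refl) refl

mainTheorem17 : (N+I ⊢ target) × ¬ (NoAx ⊢ target)
mainTheorem17 = ¬□⊥⇒¬¬□⇒□¬¬ (inj₁ refl) (inj₂ refl) , CK⊬target
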